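{- For an integer $k\geq 1$, let $G_k$ be the graph with vertex set $\{x,y\}\cup\{a_1,\dots,a_k\}\cup\{b_1,\dots,b_k\}$ and edge set consisting of $a_ia_{i+1}, b_ib_{i+1}, a_ib_{i+1}, b_ia_{i+1}$ for all $i\in\{1,\dots,k-1\}$, together with $xy, xa_1, xb_1, ya_1, yb_1$. Let $k\geq 2$ and $n=2k+2=|V(G_k)|$. Then $\nu(G_k)=2^{n-4}-1$, where $\nu(G)$ denotes the number of NAC-colourings of $G$ divided by $2$.
   Context: A NAC-colouring of a graph $G$ is a surjective map $c\colon E(G)\to\{\mathrm{red},\mathrm{blue}\}$ such that every cycle of $G$ is either monochromatic or contains at least two red and at least two blue edges. -}

module Defs where

open import Data.Nat using (ℕ; zero; suc; _+_; _≤_; _∸_; NonZero)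
open import Data.Bool using (Bool; true; false)
open import Data.Fin using (Fin; zero; suc; inject₁; _↑ˡ_; _↑ʳ_)
open import Data.Fin.Properties using ()
open import Data.List using (List; []; _∷_; _++_; length; concatMap; allFin; filterᵇ; tabulate; lookup)
open import Data.List.Relation.Unary.Unique.Propositional using (Unique)
open import Data.List.Membership.Propositional using (_∈_)
open import Data.Vec using (Vec) renaming (lookup to vlookup)
open import Data.Product using (_×_; _,_; ∃; ∃-syntax)
open import Data.Sum using (_⊎_)
open import Function.Definitions using (Injective)
open import Relation.Binary.PropositionalEquality using (_≡_)
open import Function.Bundles using (_⇔_)

-- A finite (multi)graph given by n vertices and a list of edges (unordered pairs,
-- each stored once as an ordered pair).
record Graph : Set where
  field
    n     : ℕ
    edges : List (Fin n × Fin n)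

  m : ℕ
  m = length edges

  edge : Fin m → Fin n × Fin n
  edge = lookup edges

open Graph public

Joins : {n : ℕ} → Fin n × Fin n → Fin n → Fin n → Set
Joins (a , b) u v = (a ≡ u × b ≡ v) ⊎ (a ≡ v × b ≡ u)

-- cyclic successor on Fin (suc l)
next : {l : ℕ} → Fin (suc l) → Fin (suc l)
next {zero}  zero = zero
next {suc l} zero = suc zero
next {suc l} (suc i) with next {l} i
... | zero  = zero
... | suc j = suc (suc j)

record Cycle (G : Graph) : Set where
  field
    l      : ℕ                     -- len = l + 1
    long   : 3 ≤ suc l
    vert   : Fin (suc l) → Fin (n G)
    vinj   : Injective _≡_ _≡_ vert
    eds    : Fin (suc l) → Fin (m G)
    conn   : ∀ i → Joins (edge G (eds i)) (vert i) (vert (next i))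

-- an edge colouring: true = red, false = blue
Colouring : Graph → Set
Colouring G = Vec Bool (m G)

isRed : Bool → Bool
isRed b = b

reds : {G : Graph} → Colouring G → Cycle G → ℕ
reds c C = length (filterᵇ isRed (tabulate (λ i → vlookup c (Cycle.eds C i))))

IsNAC : (G : Graph) → Colouring G → Set
IsNAC G c =
  ((∃[ i ] vlookup c i ≡ true) × (∃[ j ] vlookup c j ≡ false)) ×
  (∀ (C : Cycle G) →
     let r = reds c C ; len = suc (Cycle.l C) in
     r ≡ 0 ⊎ r ≡ len ⊎ (2 ≤ r × 2 ≤ len ∸ r))

NACList : (G : Graph) → List (Colouring G) → Set
NACList G L = Unique L × (∀ c → (c ∈ L) ⇔ IsNAC G c)

module _ (k : ℕ) where
  V : Set
  V = Fin (2 + (k + k))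
  vx vy : V
  vx = zero
  vy = suc zero
  va vb : Fin k → V
  va i = suc (suc (i ↑ˡ k))
  vb i = suc (suc (k ↑ʳ i))

Gk : (k : ℕ) → .{{NonZero k}} → Graph
Gk (suc k) = record
  { n = 2 + (suc k + suc k)
  ; edges = (x , y) ∷ (x , a zero) ∷ (x , b zero) ∷ (y , a zero) ∷ (y , b zero) ∷
            concatMap (λ i → (a (inject₁ i) , a (suc i)) ∷ (b (inject₁ i) , b (suc i))
                           ∷ (a (inject₁ i) , b (suc i)) ∷ (b (inject₁ i) , a (suc i)) ∷ [])
                      (allFin k)
  }
  where
  x = vx (suc k)
  y = vy (suc k)
  a = va (suc k)
  b = vb (suc k)

{-# OPTIONS --safe #-}
-- Up to the choice of the colour c₀ of the five edges at x and y, the NAC-colourings of G_k are the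
-- shifted cuts c(uw) = c₀ ⊕ ψ(u) ⊕ ψ(w) of the nonzero maps ψ : V → Bool vanishing on x, y, a₁, b₁.
-- Necessity: the triangles x y a₁ and x y b₁ are monochromatic, and every 4-cycle has an even number
-- of red edges.  Define ψ along each rail by ψ(a_{j+1}) = ψ(a_j) ⊕ c₀ ⊕ c(a_j a_{j+1}), and likewise
-- for b.  Level by level, each edge u w with u ∈ {a_j, b_j} and w ∈ {a_{j+1}, b_{j+1}} lies on a
-- 4-cycle z u w u′ (z = x or a_{j-1} adjacent to both a_j and b_j) whose other edges already fit ψ
-- (taking the diagonal edges first), so it fits ψ too.
-- Sufficiency: a cycle cannot have a single edge of colour ¬β once some vertex labelling is equal
-- exactly across the β-edges; for β = c₀ take ψ, for β = ¬c₀ take ψ ⊕ (parity of the level) with two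
-- fresh labels for x and y.  As ψ is free on the n - 4 other vertices, there are 2 (2^(n-4) - 1).
module Submission where

open import Defs
open import Data.Nat using (ℕ; _≤_; _^_; _∸_; _/_; NonZero)
open import Data.List using (List; length)
open import Data.Product using (_×_; ∃-syntax)
open import Relation.Binary.PropositionalEquality using (_≡_)

open import Algebra.Solver.Ring.AlmostCommutativeRing using (fromCommutativeRing)
open import Data.Bool using (Bool; true; false; not; _xor_; if_then_else_)
open import Data.Bool.Properties
  using (xor-∧-commutativeRing; xor-same; xor-identityʳ; xor-assoc; xor-comm; not-¬; not-injective)
  renaming (_≟_ to _≟ᵇ_)
open import Data.Empty using (⊥-elim)
open import Data.Fin using (Fin; zero; suc; toℕ; inject₁; fromℕ; punchIn; splitAt; _↑ˡ_; _↑ʳ_)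
open import Data.Fin.Induction using (<-weakInduction)
open import Data.Fin.Properties
  using (punchInᵢ≢i; toℕ-inject₁; splitAt-↑ˡ; splitAt-↑ʳ; splitAt⁻¹-↑ˡ; splitAt⁻¹-↑ʳ)
open import Data.List using ([]; _∷_; _++_; map; filterᵇ; tabulate; lookup; allFin; cartesianProduct)
open import Data.List.Properties using (length-map; length-++)
open import Data.List.Membership.Propositional using (_∈_)
open import Data.List.Membership.Propositional.Properties
  using (∈-lookup; ∈-map⁺; ∈-map⁻; ∈-++⁺ˡ; ∈-++⁺ʳ; ∈-++⁻; ∈-concatMap⁺; ∈-concatMap⁻; ∈-allFin;
         ∈-cartesianProduct⁺; ∈-cartesianProduct⁻)
open import Data.List.Relation.Unary.All using ([]; _∷_)
import Data.List.Relation.Unary.All as All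
open import Data.List.Relation.Unary.AllPairs using ([]; _∷_)
import Data.List.Relation.Unary.Any as Any
open Any using (here; there)
open import Data.List.Relation.Unary.Any.Properties using (lookup-index)
open import Data.List.Relation.Unary.Unique.Propositional using (Unique)
open import Data.List.Relation.Unary.Unique.Propositional.Properties using (map⁺; ++⁺; cartesianProduct⁺)
open import Data.Nat using (zero; suc; _+_; _*_; z≤n; s≤s)
open import Data.Nat.DivMod using (m*n/n≡m)
open import Data.Nat.Properties
  using (+-0-commutativeMonoid; +-cancelʳ-≡; +-comm; +-suc; +-identityʳ; *-comm; m+n∸n≡m; n≮n;
         ≤-refl; ≤-trans; ≤-reflexive; n≤1+n; 1+n≢n; suc-injective)
open import Data.Product using (_,_; proj₁; proj₂)
open import Data.Product.Properties using (,-injective)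
open import Data.Sum using (_⊎_; inj₁; inj₂; [_,_]′)
open import Data.Vec using (Vec; []; _∷_) renaming (lookup to vlookup; tabulate to vtabulate)
open import Data.Vec.Membership.Propositional using () renaming (_∈_ to _∈ᵥ_)
open import Data.Vec.Membership.Propositional.Properties using () renaming (∈-lookup to ∈ᵥ-lookup)
open import Data.Vec.Properties using (∷-injectiveʳ; lookup∘tabulate; tabulate∘lookup; tabulate-cong)
import Data.Vec.Relation.Unary.Any as VecAny
open import Data.Vec.Relation.Unary.Any.Properties using () renaming (lookup-index to lookup-indexᵥ)
open import Function using (_∘_)
open import Function.Bundles using (_⇔_; mk⇔; Equivalence)
open import Function.Definitions using (Injective)
import Function.Properties.Equivalence as ⇔
open import Relation.Nullary using (¬_)
open import Relation.Binary.PropositionalEquality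
  using (_≢_; refl; sym; trans; cong; cong₂; subst; ≢-sym; module ≡-Reasoning)

open Equivalence using (to; from)
open import Algebra.Properties.CommutativeMonoid.Sum +-0-commutativeMonoid
  using (sum; sum-remove; sum-init-last; sum-cong-≗)
open import Algebra.Solver.Ring.Simple (fromCommutativeRing xor-∧-commutativeRing) _≟ᵇ_
  using (solve; _:+_; _:=_; con)

CycleCondition : ℕ → ℕ → Set
CycleCondition r len = r ≡ 0 ⊎ r ≡ len ⊎ (2 ≤ r × 2 ≤ len ∸ r)

redCount : List Bool → ℕ
redCount bs = length (filterᵇ isRed bs)

trues : {N : ℕ} → (Fin N → Bool) → ℕ
trues g = redCount (tabulate g)

trues≡0⇒false : {N : ℕ} (g : Fin N → Bool) → trues g ≡ 0 → ∀ i → g i ≡ false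
trues≡0⇒false {suc N} g none i with g zero in g₀
trues≡0⇒false g none zero    | false = g₀
trues≡0⇒false g none (suc i) | false = trues≡0⇒false (g ∘ suc) none i

trues≡1⇒single : {N : ℕ} (g : Fin N → Bool) → trues g ≡ 1 →
  ∃[ i ] g i ≡ true × (∀ j → j ≢ i → g j ≡ false)
trues≡1⇒single {suc N} g one with g zero in g₀
... | true  = zero , g₀ , λ { zero 0≢0 → ⊥-elim (0≢0 refl)
                             ; (suc j) _ → trues≡0⇒false (g ∘ suc) (suc-injective one) j }
... | false with trues≡1⇒single (g ∘ suc) one
...   | i , gᵢ , others = suc i , gᵢ , λ { zero _ → g₀ ; (suc j) j≢i → others j (j≢i ∘ cong suc) }

trues∘not+trues : {N : ℕ} (g : Fin N → Bool) → trues (not ∘ g) + trues g ≡ N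
trues∘not+trues {zero}  g = refl
trues∘not+trues {suc N} g with g zero
... | true  = trans (+-suc _ _) (cong suc (trues∘not+trues (g ∘ suc)))
... | false = cong suc (trues∘not+trues (g ∘ suc))

≢1⇒CycleCondition : ∀ {len} r r′ → r′ + r ≡ len → r ≢ 1 → r′ ≢ 1 → CycleCondition r len
≢1⇒CycleCondition zero          _              _    _   _    = inj₁ refl
≢1⇒CycleCondition (suc zero)    _              _    r≢1 _    = ⊥-elim (r≢1 refl)
≢1⇒CycleCondition (suc (suc r)) zero           refl _   _    = inj₂ (inj₁ refl)
≢1⇒CycleCondition (suc (suc r)) (suc zero)     _    _   r′≢1 = ⊥-elim (r′≢1 refl)
≢1⇒CycleCondition (suc (suc r)) (suc (suc r′)) refl _   _    =
  inj₂ (inj₂ (s≤s (s≤s z≤n) , subst (2 ≤_) (sym (m+n∸n≡m (2 + r′) (2 + r))) (s≤s (s≤s z≤n))))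

lone-red-violates : ∀ {len} → ¬ CycleCondition 1 (suc (suc len))
lone-red-violates (inj₁ ())
lone-red-violates (inj₂ (inj₁ ()))
lone-red-violates (inj₂ (inj₂ (s≤s () , _)))

lone-blue-violates : ∀ {r} → ¬ CycleCondition (suc r) (suc (suc r))
lone-blue-violates (inj₁ ())
lone-blue-violates (inj₂ (inj₁ eq)) = 1+n≢n (sym eq)
lone-blue-violates {r} (inj₂ (inj₂ (_ , two≤))) with subst (2 ≤_) (m+n∸n≡m 1 r) two≤
... | s≤s ()

-- Triangles and squares in NAC-colourings

CycleCondition₃⇒constant : ∀ g₀ g₁ g₂ → CycleCondition (redCount (g₀ ∷ g₁ ∷ g₂ ∷ [])) 3 →
  g₀ ≡ g₁ × g₁ ≡ g₂
CycleCondition₃⇒constant true  true  true  _ = refl , refl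
CycleCondition₃⇒constant false false false _ = refl , refl
CycleCondition₃⇒constant true  true  false h = ⊥-elim (lone-blue-violates h)
CycleCondition₃⇒constant true  false true  h = ⊥-elim (lone-blue-violates h)
CycleCondition₃⇒constant false true  true  h = ⊥-elim (lone-blue-violates h)
CycleCondition₃⇒constant true  false false h = ⊥-elim (lone-red-violates h)
CycleCondition₃⇒constant false true  false h = ⊥-elim (lone-red-violates h)
CycleCondition₃⇒constant false false true  h = ⊥-elim (lone-red-violates h)

CycleCondition₄⇒even : ∀ g₀ g₁ g₂ g₃ → CycleCondition (redCount (g₀ ∷ g₁ ∷ g₂ ∷ g₃ ∷ [])) 4 →
  g₀ ≡ g₁ xor (g₂ xor g₃)
CycleCondition₄⇒even true  true  true  true  _ = refl
CycleCondition₄⇒even true  true  false false _ = refl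
CycleCondition₄⇒even true  false true  false _ = refl
CycleCondition₄⇒even true  false false true  _ = refl
CycleCondition₄⇒even false true  true  false _ = refl
CycleCondition₄⇒even false true  false true  _ = refl
CycleCondition₄⇒even false false true  true  _ = refl
CycleCondition₄⇒even false false false false _ = refl
CycleCondition₄⇒even true  true  true  false h = ⊥-elim (lone-blue-violates h)
CycleCondition₄⇒even true  true  false true  h = ⊥-elim (lone-blue-violates h)
CycleCondition₄⇒even true  false true  true  h = ⊥-elim (lone-blue-violates h)
CycleCondition₄⇒even false true  true  true  h = ⊥-elim (lone-blue-violates h)
CycleCondition₄⇒even true  false false false h = ⊥-elim (lone-red-violates h)
CycleCondition₄⇒even false true  false false h = ⊥-elim (lone-red-violates h)
CycleCondition₄⇒even false false true  false h = ⊥-elim (lone-red-violates h)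
CycleCondition₄⇒even false false false true  h = ⊥-elim (lone-red-violates h)

Joins-sym : ∀ {N} {p : Fin N × Fin N} {u w} → Joins p u w → Joins p w u
Joins-sym (inj₁ ends) = inj₂ ends
Joins-sym (inj₂ ends) = inj₁ ends

≡⇒Joins : ∀ {N} {p : Fin N × Fin N} {u w} → p ≡ (u , w) → Joins p u w
≡⇒Joins refl = inj₁ (refl , refl)

lookup-injective : {A : Set} {xs : List A} → Unique xs → Injective _≡_ _≡_ (lookup xs)
lookup-injective               (_ ∷ _)        {zero}  {zero}  _  = refl
lookup-injective {xs = _ ∷ xs} (x∉xs ∷ _)     {zero}  {suc j} eq =
  ⊥-elim (All.lookup x∉xs (∈-lookup {xs = xs} j) eq)
lookup-injective {xs = _ ∷ xs} (x∉xs ∷ _)     {suc i} {zero}  eq =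
  ⊥-elim (All.lookup x∉xs (∈-lookup {xs = xs} i) (sym eq))
lookup-injective               (_ ∷ distinct) {suc i} {suc j} eq =
  cong suc (lookup-injective distinct eq)

cycleThrough : (G : Graph) (w : Fin (n G)) (ws : List (Fin (n G))) → 2 ≤ length ws → Unique (w ∷ ws) →
  (es : Fin (suc (length ws)) → Fin (m G)) →
  (∀ i → Joins (edge G (es i)) (lookup (w ∷ ws) i) (lookup (w ∷ ws) (next i))) → Cycle G
cycleThrough G w ws long distinct es joins = record
  { l = length ws ; long = s≤s long ; vert = lookup (w ∷ ws) ; vinj = lookup-injective distinct
  ; eds = es ; conn = joins }

module _ {G : Graph} {c : Colouring G} (nac : IsNAC G c) where

  triangle-monochromatic : ∀ {w₀ w₁ w₂} e₀ e₁ e₂ → Unique (w₀ ∷ w₁ ∷ w₂ ∷ []) →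
    Joins (edge G e₀) w₀ w₁ → Joins (edge G e₁) w₁ w₂ → Joins (edge G e₂) w₂ w₀ →
    vlookup c e₀ ≡ vlookup c e₁ × vlookup c e₁ ≡ vlookup c e₂
  triangle-monochromatic e₀ e₁ e₂ distinct j₀ j₁ j₂ =
    CycleCondition₃⇒constant _ _ _ (proj₂ nac (cycleThrough G _ _ (s≤s (s≤s z≤n)) distinct
      (λ { zero → e₀ ; (suc zero) → e₁ ; (suc (suc zero)) → e₂ })
      (λ { zero → j₀ ; (suc zero) → j₁ ; (suc (suc zero)) → j₂ })))

  square-even : ∀ {w₀ w₁ w₂ w₃} e₀ e₁ e₂ e₃ → Unique (w₀ ∷ w₁ ∷ w₂ ∷ w₃ ∷ []) →
    Joins (edge G e₀) w₀ w₁ → Joins (edge G e₁) w₁ w₂ → Joins (edge G e₂) w₂ w₃ →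
    Joins (edge G e₃) w₃ w₀ → vlookup c e₀ ≡ vlookup c e₁ xor (vlookup c e₂ xor vlookup c e₃)
  square-even e₀ e₁ e₂ e₃ distinct j₀ j₁ j₂ j₃ =
    CycleCondition₄⇒even _ _ _ _ (proj₂ nac (cycleThrough G _ _ (s≤s (s≤s z≤n)) distinct
      (λ { zero → e₀ ; (suc zero) → e₁ ; (suc (suc zero)) → e₂ ; (suc (suc (suc zero))) → e₃ })
      (λ { zero → j₀ ; (suc zero) → j₁ ; (suc (suc zero)) → j₂ ; (suc (suc (suc zero))) → j₃ })))

next-inject₁ : ∀ {l} (j : Fin l) → next (inject₁ j) ≡ suc j
next-inject₁ {suc l} zero    = refl
next-inject₁ {suc l} (suc j) rewrite next-inject₁ j = refl

next-fromℕ : ∀ l → next (fromℕ l) ≡ zero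
next-fromℕ zero    = refl
next-fromℕ (suc l) rewrite next-fromℕ l = refl

sum-∘next : ∀ {l} (F : Fin (suc l) → ℕ) → sum (F ∘ next) ≡ sum F
sum-∘next {l} F = begin
  sum (F ∘ next)                                  ≡⟨ sum-init-last (F ∘ next) ⟩
  sum (F ∘ next ∘ inject₁) + F (next (fromℕ l))   ≡⟨ cong₂ _+_ (sum-cong-≗ (cong F ∘ next-inject₁))
                                                               (cong F (next-fromℕ l)) ⟩
  sum (F ∘ suc) + F zero                          ≡⟨ +-comm _ (F zero) ⟩
  sum F                                           ∎
  where open ≡-Reasoning

sum-agree-at : ∀ {l} (F H : Fin (suc l) → ℕ) i → sum F ≡ sum H → (∀ j → j ≢ i → F j ≡ H j) → F i ≡ H i
sum-agree-at F H i ΣF≡ΣH agree = +-cancelʳ-≡ (sum (F ∘ punchIn i)) (F i) (H i) (begin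
  F i + sum (F ∘ punchIn i) ≡⟨ sum-remove F ⟨
  sum F                     ≡⟨ ΣF≡ΣH ⟩
  sum H                     ≡⟨ sum-remove H ⟩
  H i + sum (H ∘ punchIn i) ≡⟨ cong (H i +_) (sum-cong-≗ (λ j → agree (punchIn i j) (punchInᵢ≢i i j))) ⟨
  H i + sum (F ∘ punchIn i) ∎)
  where open ≡-Reasoning

Joins-≡⇔ : ∀ {N} {A : Set} (f : Fin N → A) {p u w} → Joins p u w →
  (f (proj₁ p) ≡ f (proj₂ p)) ⇔ (f u ≡ f w)
Joins-≡⇔ f (inj₁ (refl , refl)) = ⇔.refl
Joins-≡⇔ f (inj₂ (refl , refl)) = mk⇔ sym sym

-- Such a labelling exists iff no edge of colour ≠ β joins two vertices of one component of the
-- β-coloured subgraph (label the components).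
Labelling : (G : Graph) → Colouring G → Bool → (Fin (n G) → ℕ) → Set
Labelling G c β f = ∀ e → (vlookup c e ≡ β) ⇔ (f (proj₁ (edge G e)) ≡ f (proj₂ (edge G e)))

-- Along the cycle the label changes at most at edge i, yet the labels of the vertices and of their
-- successors have the same sum.
lone-edge-colour : ∀ {G c β f} → Labelling G c β f → (C : Cycle G) → ∀ i →
  (∀ j → j ≢ i → vlookup c (Cycle.eds C j) ≡ β) → vlookup c (Cycle.eds C i) ≡ β
lone-edge-colour {G} {c} {β} {f} lab C i others =
  from (along i) (sum-agree-at (f ∘ vert) (f ∘ vert ∘ next) i (sym (sum-∘next (f ∘ vert)))
                               (λ j j≢i → to (along j) (others j j≢i)))
  where
  open Cycle C
  along : ∀ j → (vlookup c (eds j) ≡ β) ⇔ (f (vert j) ≡ f (vert (next j)))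
  along j = ⇔.trans (lab (eds j)) (Joins-≡⇔ f (conn j))

labellings⇒CycleCondition : ∀ {G c f g} → Labelling G c true f → Labelling G c false g →
  ∀ (C : Cycle G) → CycleCondition (reds c C) (suc (Cycle.l C))
labellings⇒CycleCondition {c = c} {f} {g} red blue C =
  ≢1⇒CycleCondition _ _ (trues∘not+trues colours) no-lone-red no-lone-blue
  where
  colours = λ i → vlookup c (Cycle.eds C i)
  no-lone-red : trues colours ≢ 1
  no-lone-red one with trues≡1⇒single colours one
  ... | i , redᵢ , others = not-¬ redᵢ (lone-edge-colour {c = c} {f = g} blue C i others)
  no-lone-blue : trues (not ∘ colours) ≢ 1
  no-lone-blue one with trues≡1⇒single (not ∘ colours) one
  ... | i , blueᵢ , others =
        not-¬ (not-injective blueᵢ)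
              (lone-edge-colour {c = c} {f = f} red C i (λ j → not-injective ∘ others j))

UsesBothColours : (G : Graph) → Colouring G → Set
UsesBothColours G c = (∃[ i ] vlookup c i ≡ true) × (∃[ j ] vlookup c j ≡ false)

both-colours : ∀ {G} {c : Colouring G} β {e e′} → vlookup c e ≡ β → vlookup c e′ ≡ not β →
  UsesBothColours G c
both-colours true  {e} {e′} cₑ cₑ′ = (e , cₑ) , (e′ , cₑ′)
both-colours false {e} {e′} cₑ cₑ′ = (e′ , cₑ′) , (e , cₑ)

another-colour : ∀ {G} {c : Colouring G} β → UsesBothColours G c → ∃[ e ] vlookup c e ≡ not β
another-colour true  (_ , blue) = blue
another-colour false (red , _)  = red

labellings⇒IsNAC : ∀ {G c f g} β → Labelling G c β f → Labelling G c (not β) g →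
  UsesBothColours G c → IsNAC G c
labellings⇒IsNAC {c = c} {f} {g} true  lab lab′ surjective =
  surjective , labellings⇒CycleCondition {c = c} {f} {g} lab lab′
labellings⇒IsNAC {c = c} {f} {g} false lab lab′ surjective =
  surjective , labellings⇒CycleCondition {c = c} {g} {f} lab′ lab

-- Cut colourings

bit : Bool → ℕ
bit false = 0
bit true  = 1

2≤⇒≢bit : ∀ b {t} → 2 ≤ t → t ≢ bit b
2≤⇒≢bit false (s≤s _)       ()
2≤⇒≢bit true  (s≤s (s≤s _)) ()

bit-injective : ∀ {a b} → bit a ≡ bit b → a ≡ b
bit-injective {false} {false} _ = refl
bit-injective {true}  {true}  _ = refl

xor-cancelˡ : ∀ a b → a xor (a xor b) ≡ b
xor-cancelˡ a b = trans (sym (xor-assoc a a b)) (cong (_xor b) (xor-same a))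

xor-cancelʳ : ∀ a b → (a xor b) xor b ≡ a
xor-cancelʳ a b = trans (xor-assoc a b b) (trans (cong (a xor_) (xor-same b)) (xor-identityʳ a))

≡⇔≡ : ∀ {A : Set} {a b a′ b′ : A} → a ≡ a′ → b ≡ b′ → (a ≡ b) ⇔ (a′ ≡ b′)
≡⇔≡ refl refl = ⇔.refl

≡⇔xor≡false : ∀ {a b} → (a ≡ b) ⇔ (a xor b ≡ false)
≡⇔xor≡false {a} = mk⇔ (λ { refl → xor-same a }) (xor≡false⇒≡ _ _)
  where
  xor≡false⇒≡ : ∀ a b → a xor b ≡ false → a ≡ b
  xor≡false⇒≡ false false _ = refl
  xor≡false⇒≡ true  true  _ = refl

xor-≡⇔ : ∀ {a b a′ b′} → a xor b ≡ a′ xor b′ → (a ≡ b) ⇔ (a′ ≡ b′)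
xor-≡⇔ eq = ⇔.trans ≡⇔xor≡false (⇔.trans (≡⇔≡ eq refl) (⇔.sym ≡⇔xor≡false))

xor≡not⇒true : ∀ a b c → (a xor b) xor c ≡ not c → a ≡ true ⊎ b ≡ true
xor≡not⇒true true  _     _ _  = inj₁ refl
xor≡not⇒true false true  _ _  = inj₂ refl
xor≡not⇒true false false _ eq = ⊥-elim (not-¬ refl eq)

cutColour : {A : Set} → Bool → (A → Bool) → A × A → Bool
cutColour c₀ ψ (u , w) = (ψ u xor ψ w) xor c₀

cutColour-sym : ∀ {A : Set} c₀ (ψ : A → Bool) u w → cutColour c₀ ψ (u , w) ≡ cutColour c₀ ψ (w , u)
cutColour-sym c₀ ψ u w = cong (_xor c₀) (xor-comm (ψ u) (ψ w))

cut-labelling : ∀ {G c c₀ ψ} → (∀ e → vlookup c e ≡ cutColour c₀ ψ (edge G e)) →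
  Labelling G c c₀ (bit ∘ ψ)
cut-labelling {c₀ = c₀} {ψ} cut e =
  ⇔.trans (xor-≡⇔ (trans (cong (_xor c₀) (cut e)) (xor-cancelʳ (ψ _ xor ψ _) c₀)))
          (mk⇔ (cong bit) bit-injective)

square-cutColour : ∀ {G c} → IsNAC G c → ∀ c₀ ψ {w₀ w₁ w₂ w₃} e₀ e₁ e₂ e₃ →
  Unique (w₀ ∷ w₁ ∷ w₂ ∷ w₃ ∷ []) →
  Joins (edge G e₀) w₀ w₁ → Joins (edge G e₁) w₁ w₂ → Joins (edge G e₂) w₂ w₃ → Joins (edge G e₃) w₃ w₀ →
  vlookup c e₁ ≡ cutColour c₀ ψ (w₁ , w₂) → vlookup c e₂ ≡ cutColour c₀ ψ (w₂ , w₃) →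
  vlookup c e₃ ≡ cutColour c₀ ψ (w₃ , w₀) → vlookup c e₀ ≡ cutColour c₀ ψ (w₀ , w₁)
square-cutColour {c = c} nac c₀ ψ {w₀} {w₁} {w₂} {w₃} e₀ e₁ e₂ e₃ distinct j₀ j₁ j₂ j₃ cut₁ cut₂ cut₃ =
  begin
  vlookup c e₀                                       ≡⟨ square-even {c = c} nac e₀ e₁ e₂ e₃ distinct
                                                                    j₀ j₁ j₂ j₃ ⟩
  vlookup c e₁ xor (vlookup c e₂ xor vlookup c e₃)   ≡⟨ cong₂ _xor_ cut₁ (cong₂ _xor_ cut₂ cut₃) ⟩
  cutColour c₀ ψ (w₁ , w₂) xor (cutColour c₀ ψ (w₂ , w₃) xor cutColour c₀ ψ (w₃ , w₀))
                                                     ≡⟨ closed-square c₀ (ψ w₀) (ψ w₁) (ψ w₂) (ψ w₃) ⟩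
  cutColour c₀ ψ (w₀ , w₁)                           ∎
  where
  open ≡-Reasoning
  closed-square : ∀ c p q r s →
    ((q xor r) xor c) xor (((r xor s) xor c) xor ((s xor p) xor c)) ≡ (p xor q) xor c
  closed-square = solve 5 (λ c p q r s →
    ((q :+ r) :+ c) :+ (((r :+ s) :+ c) :+ ((s :+ p) :+ c)) := (p :+ q) :+ c) refl

-- Bit vectors

length-cartesianProduct : {A B : Set} (xs : List A) (ys : List B) →
  length (cartesianProduct xs ys) ≡ length xs * length ys
length-cartesianProduct []       ys = refl
length-cartesianProduct (x ∷ xs) ys =
  trans (length-++ (map (x ,_) ys)) (cong₂ _+_ (length-map (x ,_) ys) (length-cartesianProduct xs ys))

branch : ∀ {N} → List (Vec Bool N) → List (Vec Bool N) → List (Vec Bool (suc N))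
branch xs ys = map (false ∷_) xs ++ map (true ∷_) ys

∈-branch : ∀ {N} {xs ys : List (Vec Bool N)} {b bs} →
  (b ∷ bs) ∈ branch xs ys ⇔ bs ∈ (if b then ys else xs)
∈-branch {xs = xs} {ys} = mk⇔ to′ (from′ _)
  where
  to′ : ∀ {b bs} → (b ∷ bs) ∈ branch xs ys → bs ∈ (if b then ys else xs)
  to′ mem with ∈-++⁻ (map (false ∷_) xs) mem
  ... | inj₁ left  with ∈-map⁻ (false ∷_) left
  ...   | _ , bs∈xs , refl = bs∈xs
  to′ mem | inj₂ right with ∈-map⁻ (true ∷_) right
  ...   | _ , bs∈ys , refl = bs∈ys
  from′ : ∀ b {bs} → bs ∈ (if b then ys else xs) → (b ∷ bs) ∈ branch xs ys
  from′ false bs∈xs = ∈-++⁺ˡ (∈-map⁺ (false ∷_) bs∈xs)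
  from′ true  bs∈ys = ∈-++⁺ʳ (map (false ∷_) xs) (∈-map⁺ (true ∷_) bs∈ys)

branch-unique : ∀ {N} {xs ys : List (Vec Bool N)} → Unique xs → Unique ys → Unique (branch xs ys)
branch-unique {xs = xs} {ys} xs! ys! = ++⁺ (map⁺ ∷-injectiveʳ xs!) (map⁺ ∷-injectiveʳ ys!) disjoint
  where
  disjoint : ∀ {v} → ¬ (v ∈ map (false ∷_) xs × v ∈ map (true ∷_) ys)
  disjoint (left , right) with ∈-map⁻ (false ∷_) left | ∈-map⁻ (true ∷_) right
  ... | _ , _ , refl | _ , _ , ()

length-branch : ∀ {N} (xs ys : List (Vec Bool N)) → length (branch xs ys) ≡ length xs + length ys
length-branch xs ys =
  trans (length-++ (map (false ∷_) xs)) (cong₂ _+_ (length-map (false ∷_) xs) (length-map (true ∷_) ys))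

bitVectors : (N : ℕ) → List (Vec Bool N)
bitVectors zero    = [] ∷ []
bitVectors (suc N) = branch (bitVectors N) (bitVectors N)

nonzeroBitVectors : (N : ℕ) → List (Vec Bool N)
nonzeroBitVectors zero    = []
nonzeroBitVectors (suc N) = branch (nonzeroBitVectors N) (bitVectors N)

∈-bitVectors : ∀ {N} (bs : Vec Bool N) → bs ∈ bitVectors N
∈-bitVectors []           = here refl
∈-bitVectors (false ∷ bs) = from ∈-branch (∈-bitVectors bs)
∈-bitVectors (true  ∷ bs) = from ∈-branch (∈-bitVectors bs)

∈-nonzeroBitVectors : ∀ {N} {bs : Vec Bool N} → bs ∈ nonzeroBitVectors N ⇔ true ∈ᵥ bs
∈-nonzeroBitVectors {bs = []}         = mk⇔ (λ ()) (λ ())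
∈-nonzeroBitVectors {bs = false ∷ bs} =
  ⇔.trans ∈-branch (⇔.trans ∈-nonzeroBitVectors
                            (mk⇔ VecAny.there λ { (VecAny.here ()) ; (VecAny.there one) → one }))
∈-nonzeroBitVectors {bs = true  ∷ bs} =
  mk⇔ (λ _ → VecAny.here refl) (λ _ → from ∈-branch (∈-bitVectors bs))

bitVectors-unique : ∀ N → Unique (bitVectors N)
bitVectors-unique zero    = [] ∷ []
bitVectors-unique (suc N) = branch-unique (bitVectors-unique N) (bitVectors-unique N)

nonzeroBitVectors-unique : ∀ N → Unique (nonzeroBitVectors N)
nonzeroBitVectors-unique zero    = []
nonzeroBitVectors-unique (suc N) = branch-unique (nonzeroBitVectors-unique N) (bitVectors-unique N)

length-bitVectors : ∀ N → length (bitVectors N) ≡ 2 ^ N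
length-bitVectors zero    = refl
length-bitVectors (suc N) = trans (length-branch (bitVectors N) (bitVectors N))
  (cong₂ _+_ (length-bitVectors N) (trans (length-bitVectors N) (sym (+-identityʳ (2 ^ N)))))

length-nonzeroBitVectors : ∀ N → suc (length (nonzeroBitVectors N)) ≡ 2 ^ N
length-nonzeroBitVectors zero    = refl
length-nonzeroBitVectors (suc N) = trans (cong suc (length-branch (nonzeroBitVectors N) (bitVectors N)))
  (cong₂ _+_ (length-nonzeroBitVectors N) (trans (length-bitVectors N) (sym (+-identityʳ (2 ^ N)))))

prefixXor : ∀ {k} → (Fin k → Bool) → Fin (suc k) → Bool
prefixXor u zero = false
prefixXor {suc k} u (suc i) = u zero xor prefixXor (u ∘ suc) i

prefixXor-step : ∀ {k} (u : Fin k → Bool) i → prefixXor u (suc i) ≡ prefixXor u (inject₁ i) xor u i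
prefixXor-step u zero    = xor-identityʳ (u zero)
prefixXor-step u (suc i) =
  trans (cong (u zero xor_) (prefixXor-step (u ∘ suc) i)) (sym (xor-assoc (u zero) _ _))

prefixXor≡true : ∀ {k} (u : Fin k → Bool) j → prefixXor u j ≡ true → ∃[ i ] u i ≡ true
prefixXor≡true {suc k} u (suc j) odd with u zero in u₀
... | true  = zero , u₀
... | false with prefixXor≡true (u ∘ suc) j odd
...   | i , uᵢ = suc i , uᵢ

parity : ∀ {k} → Fin (suc k) → Bool
parity = prefixXor (λ _ → true)

-- The graph G_k

data Rail : Set where
  railA railB : Rail

opposite : Rail → Rail
opposite railA = railB
opposite railB = railA

≢-opposite : ∀ s → s ≢ opposite s
≢-opposite railA ()
≢-opposite railB ()

-- Ladder k is about G_(k+1): the paper's a_(j+1) and b_(j+1) are on railA j and on railB j for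
-- j : Fin (suc k), and link i s s′ joins level i of rail s to level i+1 of rail s′.
module Ladder (k : ℕ) where

  G : Graph
  G = Gk (suc k)

  Vertex : Set
  Vertex = Fin (n G)

  x y : Vertex
  x = vx (suc k)
  y = vy (suc k)

  on : Rail → Fin (suc k) → Vertex
  on railA = va (suc k)
  on railB = vb (suc k)

  vertexRec : {A : Set} → A → A → (Rail → Fin (suc k) → A) → Vertex → A
  vertexRec ax ay f zero          = ax
  vertexRec ax ay f (suc zero)    = ay
  vertexRec ax ay f (suc (suc v)) = [ f railA , f railB ]′ (splitAt (suc k) v)

  vertexRec-on : ∀ {A : Set} {ax ay : A} {f} s j → vertexRec ax ay f (on s j) ≡ f s j
  vertexRec-on {f = f} railA j = cong [ f railA , f railB ]′ (splitAt-↑ˡ (suc k) j (suc k))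
  vertexRec-on {f = f} railB j = cong [ f railA , f railB ]′ (splitAt-↑ʳ (suc k) (suc k) j)

  on-injective : ∀ {s s′ j j′} → on s j ≡ on s′ j′ → s ≡ s′ × j ≡ j′
  on-injective {s} {s′} {j} {j′} eq = ,-injective (begin
    (s , j)                                  ≡⟨ vertexRec-on s j ⟨
    vertexRec (s , j) (s , j) _,_ (on s j)   ≡⟨ cong (vertexRec (s , j) (s , j) _,_) eq ⟩
    vertexRec (s , j) (s , j) _,_ (on s′ j′) ≡⟨ vertexRec-on s′ j′ ⟩
    (s′ , j′)                                ∎)
    where open ≡-Reasoning

  rails-≢ : ∀ {s s′ j j′} → s ≢ s′ → on s j ≢ on s′ j′
  rails-≢ {s} {s′} s≢s′ = s≢s′ ∘ proj₁ ∘ on-injective {s} {s′}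

  levels-≢ : ∀ {s s′ j j′} → toℕ j ≢ toℕ j′ → on s j ≢ on s′ j′
  levels-≢ {s} {s′} j≢j′ = j≢j′ ∘ cong toℕ ∘ proj₂ ∘ on-injective {s} {s′}

  x≢on : ∀ s {j} → x ≢ on s j
  x≢on railA ()
  x≢on railB ()

  y≢on : ∀ s {j} → y ≢ on s j
  y≢on railA ()
  y≢on railB ()

  inject₁≢suc : ∀ (i : Fin k) → toℕ (inject₁ i) ≢ suc (toℕ i)
  inject₁≢suc i eq = 1+n≢n (sym (trans (sym (toℕ-inject₁ i)) eq))

  data Edge : Set where
    xy   : Edge
    xTo  : Rail → Edge
    yTo  : Rail → Edge
    link : Fin k → Rail → Rail → Edge

  ends : Edge → Vertex × Vertex
  ends xy            = x , y
  ends (xTo s)       = x , on s zero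
  ends (yTo s)       = y , on s zero
  ends (link i s s′) = on s (inject₁ i) , on s′ (suc i)

  links : Fin k → List (Vertex × Vertex)
  links i = ends (link i railA railA) ∷ ends (link i railB railB)
          ∷ ends (link i railA railB) ∷ ends (link i railB railA) ∷ []

  link∈links : ∀ i s s′ → ends (link i s s′) ∈ links i
  link∈links i railA railA = here refl
  link∈links i railB railB = there (here refl)
  link∈links i railA railB = there (there (here refl))
  link∈links i railB railA = there (there (there (here refl)))

  edges-sound : ∀ ε → ends ε ∈ edges G
  edges-sound xy            = here refl
  edges-sound (xTo railA)   = there (here refl)
  edges-sound (xTo railB)   = there (there (here refl))
  edges-sound (yTo railA)   = there (there (there (here refl)))
  edges-sound (yTo railB)   = there (there (there (there (here refl))))
  edges-sound (link i s s′) = there (there (there (there (there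
    (∈-concatMap⁺ links (Any.map (λ { refl → link∈links i s s′ }) (∈-allFin i)))))))

  edges-complete : ∀ {p} → p ∈ edges G → ∃[ ε ] p ≡ ends ε
  edges-complete (here eq)                                 = xy , eq
  edges-complete (there (here eq))                         = xTo railA , eq
  edges-complete (there (there (here eq)))                 = xTo railB , eq
  edges-complete (there (there (there (here eq))))         = yTo railA , eq
  edges-complete (there (there (there (there (here eq))))) = yTo railB , eq
  edges-complete (there (there (there (there (there mem)))))
    with Any.satisfied (∈-concatMap⁻ links {xs = allFin k} mem)
  ... | i , here eq                         = link i railA railA , eq
  ... | i , there (here eq)                 = link i railB railB , eq
  ... | i , there (there (here eq))         = link i railA railB , eq
  ... | i , there (there (there (here eq))) = link i railB railA , eq

  index : Edge → Fin (m G)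
  index ε = Any.index (edges-sound ε)

  edge-index : ∀ ε → edge G (index ε) ≡ ends ε
  edge-index ε = sym (lookup-index (edges-sound ε))

  classify : ∀ e → ∃[ ε ] edge G e ≡ ends ε
  classify e = edges-complete (∈-lookup e)

  joins : ∀ ε → Joins (edge G (index ε)) (proj₁ (ends ε)) (proj₂ (ends ε))
  joins ε = ≡⇒Joins (edge-index ε)

  labelling-on-ends : ∀ {c β f} (κ : Vertex × Vertex → Bool) → (∀ e → vlookup c e ≡ κ (edge G e)) →
    (∀ ε → (κ (ends ε) ≡ β) ⇔ (f (proj₁ (ends ε)) ≡ f (proj₂ (ends ε)))) → Labelling G c β f
  labelling-on-ends {β = β} {f} κ colour on-ends e with classify e
  ... | ε , eq = ⇔.trans (≡⇔≡ (colour e) refl)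
                   (subst (λ p → (κ p ≡ β) ⇔ (f (proj₁ p) ≡ f (proj₂ p))) (sym eq) (on-ends ε))

  -- A code is the colour c₀ of the edges at x and y together with the colours, relative to c₀, of the
  -- edges link i s s, which sit at position railPos s i.
  Code : Set
  Code = Bool × Vec Bool (k + k)

  railPos : Rail → Fin k → Fin (k + k)
  railPos railA i = i ↑ˡ k
  railPos railB i = k ↑ʳ i

  railOf : Fin (k + k) → Rail × Fin k
  railOf p = [ (railA ,_) , (railB ,_) ]′ (splitAt k p)

  railOf-railPos : ∀ s i → railOf (railPos s i) ≡ (s , i)
  railOf-railPos railA i = cong [ (railA ,_) , (railB ,_) ]′ (splitAt-↑ˡ k i k)
  railOf-railPos railB i = cong [ (railA ,_) , (railB ,_) ]′ (splitAt-↑ʳ k k i)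

  railPos-railOf : ∀ p → railPos (proj₁ (railOf p)) (proj₂ (railOf p)) ≡ p
  railPos-railOf p with splitAt k p in split
  ... | inj₁ i = splitAt⁻¹-↑ˡ split
  ... | inj₂ i = splitAt⁻¹-↑ʳ split

  railBits : Vec Bool (k + k) → Rail → Fin k → Bool
  railBits bs s i = vlookup bs (railPos s i)

  nonzero⇒railBit : ∀ {bs} → true ∈ᵥ bs → ∃[ s ] ∃[ i ] railBits bs s i ≡ true
  nonzero⇒railBit {bs} one =
    proj₁ (railOf p) , proj₂ (railOf p) ,
    trans (cong (vlookup bs) (railPos-railOf p)) (sym (lookup-indexᵥ one))
    where p = VecAny.index one

  railBit⇒nonzero : ∀ {bs} s → ∃[ i ] railBits bs s i ≡ true → true ∈ᵥ bs
  railBit⇒nonzero {bs} s (i , bitᵢ) = subst (_∈ᵥ bs) bitᵢ (∈ᵥ-lookup (railPos s i) bs)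

  potential : Vec Bool (k + k) → Vertex → Bool
  potential bs = vertexRec false false (λ s → prefixXor (railBits bs s))

  potential-zero : ∀ bs s → potential bs (on s zero) ≡ false
  potential-zero bs s = vertexRec-on s zero

  potential-step : ∀ bs s i →
    potential bs (on s (suc i)) ≡ potential bs (on s (inject₁ i)) xor railBits bs s i
  potential-step bs s i = begin
    potential bs (on s (suc i))                                ≡⟨ vertexRec-on s (suc i) ⟩
    prefixXor (railBits bs s) (suc i)                          ≡⟨ prefixXor-step (railBits bs s) i ⟩
    prefixXor (railBits bs s) (inject₁ i) xor railBits bs s i  ≡⟨ cong (_xor railBits bs s i)
                                                                       (vertexRec-on s (inject₁ i)) ⟨
    potential bs (on s (inject₁ i)) xor railBits bs s i        ∎
    where open ≡-Reasoning

  potential≡true : ∀ bs v → potential bs v ≡ true → true ∈ᵥ bs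
  potential≡true bs (suc (suc v)) odd with splitAt (suc k) v
  ... | inj₁ j = railBit⇒nonzero railA (prefixXor≡true (railBits bs railA) j odd)
  ... | inj₂ j = railBit⇒nonzero railB (prefixXor≡true (railBits bs railB) j odd)

  encode : Code → Colouring G
  encode (c₀ , bs) = vtabulate (λ e → cutColour c₀ (potential bs) (edge G e))

  encode-cut : ∀ c₀ bs e → vlookup (encode (c₀ , bs)) e ≡ cutColour c₀ (potential bs) (edge G e)
  encode-cut c₀ bs = lookup∘tabulate _

  encode-link : ∀ c₀ bs s i → vlookup (encode (c₀ , bs)) (index (link i s s)) ≡ railBits bs s i xor c₀
  encode-link c₀ bs s i = begin
    vlookup (encode (c₀ , bs)) (index (link i s s)) ≡⟨ encode-cut c₀ bs (index (link i s s)) ⟩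
    cutColour c₀ ψ (edge G (index (link i s s)))     ≡⟨ cong (cutColour c₀ ψ) (edge-index (link i s s)) ⟩
    (p xor ψ (on s (suc i))) xor c₀                  ≡⟨ cong (λ t → (p xor t) xor c₀) (potential-step bs s i) ⟩
    (p xor (p xor railBits bs s i)) xor c₀           ≡⟨ cong (_xor c₀) (xor-cancelˡ p _) ⟩
    railBits bs s i xor c₀                           ∎
    where
    open ≡-Reasoning
    ψ = potential bs
    p = ψ (on s (inject₁ i))

  baseColour : Colouring G → Bool
  baseColour c = vlookup c (index xy)

  linkBit : Colouring G → Rail → Fin k → Bool
  linkBit c s i = vlookup c (index (link i s s)) xor baseColour c

  decode : Colouring G → Code
  decode c = baseColour c , vtabulate (λ p → linkBit c (proj₁ (railOf p)) (proj₂ (railOf p)))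

  railBits-decode : ∀ c s i → railBits (proj₂ (decode c)) s i ≡ linkBit c s i
  railBits-decode c s i =
    trans (lookup∘tabulate _ (railPos s i))
          (cong (λ q → linkBit c (proj₁ q) (proj₂ q)) (railOf-railPos s i))

  decode-encode : ∀ code → decode (encode code) ≡ code
  decode-encode (c₀ , bs) = cong (c₀ ,_) (trans (tabulate-cong bit-at) (tabulate∘lookup bs))
    where
    bit-at : ∀ p → linkBit (encode (c₀ , bs)) (proj₁ (railOf p)) (proj₂ (railOf p)) ≡ vlookup bs p
    bit-at p = begin
      linkBit (encode (c₀ , bs)) s i   ≡⟨ cong (_xor c₀) (encode-link c₀ bs s i) ⟩
      (railBits bs s i xor c₀) xor c₀  ≡⟨ xor-cancelʳ _ c₀ ⟩
      vlookup bs (railPos s i)         ≡⟨ cong (vlookup bs) (railPos-railOf p) ⟩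
      vlookup bs p                     ∎
      where
      open ≡-Reasoning
      s = proj₁ (railOf p)
      i = proj₂ (railOf p)

  encode-injective : ∀ {p q} → encode p ≡ encode q → p ≡ q
  encode-injective {p} {q} eq = trans (sym (decode-encode p)) (trans (cong decode eq) (decode-encode q))

  -- Consecutive levels have opposite parities, so across a link these labels agree exactly when the
  -- potential differs; x and y, all of whose edges have colour c₀, get labels of their own.
  alternatingLabel : Vec Bool (k + k) → Vertex → ℕ
  alternatingLabel bs = vertexRec 2 3 (λ s j → bit (prefixXor (railBits bs s) j xor parity j))

  alternating-labelling : ∀ c₀ bs → Labelling G (encode (c₀ , bs)) (not c₀) (alternatingLabel bs)
  alternating-labelling c₀ bs =
    labelling-on-ends {c = encode (c₀ , bs)} {f = f} (cutColour c₀ ψ) (encode-cut c₀ bs) on-ends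
    where
    ψ = potential bs
    f = alternatingLabel bs

    both-false : ∀ {A B : Set} → ¬ A → ¬ B → A ⇔ B
    both-false ¬a ¬b = mk⇔ (⊥-elim ∘ ¬a) (⊥-elim ∘ ¬b)

    hub : ∀ s → ψ (on s zero) xor c₀ ≢ not c₀
    hub s eq = not-¬ refl (trans (sym (cong (_xor c₀) (potential-zero bs s))) eq)

    hub-label : ∀ s {t} → 2 ≤ t → t ≢ f (on s zero)
    hub-label s 2≤t eq = 2≤⇒≢bit _ 2≤t (trans eq (vertexRec-on s zero))

    link-case : ∀ i s s′ →
      (cutColour c₀ ψ (ends (link i s s′)) ≡ not c₀) ⇔ (f (on s (inject₁ i)) ≡ f (on s′ (suc i)))
    link-case i s s′ = ⇔.trans (xor-≡⇔ twist)
      (⇔.trans (mk⇔ (cong bit) bit-injective)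
               (≡⇔≡ (sym (vertexRec-on s (inject₁ i))) (sym (vertexRec-on s′ (suc i)))))
      where
      open ≡-Reasoning
      p = prefixXor (railBits bs s) (inject₁ i)
      q = prefixXor (railBits bs s′) (suc i)
      r = parity (inject₁ i)
      flip : ∀ p q r c → ((p xor q) xor c) xor (true xor c) ≡ (p xor r) xor (q xor (r xor true))
      flip = solve 4 (λ p q r c →
        ((p :+ q) :+ c) :+ (con true :+ c) := (p :+ r) :+ (q :+ (r :+ con true))) refl
      twist : cutColour c₀ ψ (ends (link i s s′)) xor not c₀ ≡ (p xor r) xor (q xor parity (suc i))
      twist = begin
        ((ψ (on s (inject₁ i)) xor ψ (on s′ (suc i))) xor c₀) xor not c₀
          ≡⟨ cong₂ (λ a b → ((a xor b) xor c₀) xor not c₀)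
                   (vertexRec-on s (inject₁ i)) (vertexRec-on s′ (suc i)) ⟩
        ((p xor q) xor c₀) xor not c₀          ≡⟨ flip p q r c₀ ⟩
        (p xor r) xor (q xor (r xor true))
          ≡⟨ cong (λ t → (p xor r) xor (q xor t)) (prefixXor-step _ i) ⟨
        (p xor r) xor (q xor parity (suc i))   ∎

    on-ends : ∀ ε → (cutColour c₀ ψ (ends ε) ≡ not c₀) ⇔ (f (proj₁ (ends ε)) ≡ f (proj₂ (ends ε)))
    on-ends xy            = both-false (not-¬ refl) (λ ())
    on-ends (xTo s)       = both-false (hub s) (hub-label s (s≤s (s≤s z≤n)))
    on-ends (yTo s)       = both-false (hub s) (hub-label s (s≤s (s≤s z≤n)))
    on-ends (link i s s′) = link-case i s s′

  encode-IsNAC : ∀ c₀ bs → true ∈ᵥ bs → IsNAC G (encode (c₀ , bs))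
  encode-IsNAC c₀ bs one with nonzero⇒railBit one
  ... | s , i , bitᵢ =
    labellings⇒IsNAC {c = encode (c₀ , bs)} {bit ∘ potential bs} {alternatingLabel bs} c₀
      (cut-labelling {G} {encode (c₀ , bs)} {c₀} {potential bs} (encode-cut c₀ bs))
      (alternating-labelling c₀ bs)
      (both-colours {G} {encode (c₀ , bs)} c₀ {e = index xy} {e′ = index (link i s s)}
                    refl (trans (encode-link c₀ bs s i) (cong (_xor c₀) bitᵢ)))

  module Decoding (c : Colouring G) (nac : IsNAC G c) where

    c₀ : Bool
    c₀ = baseColour c

    bs : Vec Bool (k + k)
    bs = proj₂ (decode c)

    ψ : Vertex → Bool
    ψ = potential bs

    Fits : Fin (m G) → Vertex → Vertex → Set
    Fits e u w = vlookup c e ≡ cutColour c₀ ψ (u , w)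

    hub-triangle : ∀ s e₀ e₁ e₂ → Joins (edge G e₀) x y → Joins (edge G e₁) y (on s zero) →
      Joins (edge G e₂) (on s zero) x → vlookup c e₀ ≡ vlookup c e₁ × vlookup c e₁ ≡ vlookup c e₂
    hub-triangle s e₀ e₁ e₂ =
      triangle-monochromatic {c = c} nac e₀ e₁ e₂ (((λ ()) ∷ x≢on s ∷ []) ∷ (y≢on s ∷ []) ∷ [] ∷ [])

    xy-colour : ∀ e → edge G e ≡ ends xy → vlookup c e ≡ c₀
    xy-colour e eq =
      trans (proj₁ (triangle e (≡⇒Joins eq))) (sym (proj₁ (triangle (index xy) (joins xy))))
      where
      triangle = λ e jₑ → hub-triangle railA e (index (yTo railA)) (index (xTo railA))
                                       jₑ (joins (yTo railA)) (Joins-sym (joins (xTo railA)))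

    xTo-colour : ∀ s e → edge G e ≡ ends (xTo s) → vlookup c e ≡ c₀
    xTo-colour s e eq = sym (trans (proj₁ triangle) (proj₂ triangle))
      where
      triangle = hub-triangle s (index xy) (index (yTo s)) e
                              (joins xy) (joins (yTo s)) (Joins-sym (≡⇒Joins eq))

    yTo-colour : ∀ s e → edge G e ≡ ends (yTo s) → vlookup c e ≡ c₀
    yTo-colour s e eq =
      sym (proj₁ (hub-triangle s (index xy) e (index (xTo s))
                               (joins xy) (≡⇒Joins eq) (Joins-sym (joins (xTo s)))))

    hub-cut : ∀ s → ψ (on s zero) xor c₀ ≡ c₀
    hub-cut s = cong (_xor c₀) (potential-zero bs s)

    canonical-straight-fits : ∀ i s → Fits (index (link i s s)) (on s (inject₁ i)) (on s (suc i))
    canonical-straight-fits i s = begin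
      colour                                   ≡⟨ xor-cancelʳ colour c₀ ⟨
      (colour xor c₀) xor c₀                   ≡⟨ cong (_xor c₀) (xor-cancelˡ p (colour xor c₀)) ⟨
      (p xor (p xor (colour xor c₀))) xor c₀   ≡⟨ cong (λ t → (p xor t) xor c₀) step ⟨
      (p xor ψ (on s (suc i))) xor c₀          ∎
      where
      open ≡-Reasoning
      p = ψ (on s (inject₁ i))
      colour = vlookup c (index (link i s s))
      step : ψ (on s (suc i)) ≡ p xor (colour xor c₀)
      step = trans (potential-step bs s i) (cong (p xor_) (railBits-decode c s i))

    -- An anchor of level j is a vertex below level j joined to both vertices of level j by edges that
    -- fit ψ (x for level zero, on railA i for level suc i).  Every edge between levels i and suc i
    -- closes a 4-cycle through the anchor of level i whose three other edges are known to fit.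
    record Anchor (j : Fin (suc k)) : Set where
      field
        apex        : Vertex
        apex-below  : ∀ s j′ → toℕ j ≤ toℕ j′ → apex ≢ on s j′
        spoke       : Rail → Fin (m G)
        spoke-joins : ∀ s → Joins (edge G (spoke s)) apex (on s j)
        spoke-fits  : ∀ s → Fits (spoke s) apex (on s j)

    anchor-zero : Anchor zero
    anchor-zero = record
      { apex        = x
      ; apex-below  = λ s _ _ → x≢on s
      ; spoke       = index ∘ xTo
      ; spoke-joins = joins ∘ xTo
      ; spoke-fits  = λ s → trans (xTo-colour s _ (edge-index (xTo s))) (sym (hub-cut s))
      }

    module _ {i : Fin k} (anchor : Anchor (inject₁ i)) where
      open Anchor anchor

      lower≢apex : ∀ s → on s (inject₁ i) ≢ apex
      lower≢apex s = ≢-sym (apex-below s (inject₁ i) ≤-refl)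

      upper≢apex : ∀ s → on s (suc i) ≢ apex
      upper≢apex s = ≢-sym (apex-below s (suc i) (≤-trans (≤-reflexive (toℕ-inject₁ i)) (n≤1+n _)))

      lower≢upper : ∀ s s′ → on s (inject₁ i) ≢ on s′ (suc i)
      lower≢upper s s′ = levels-≢ {s} {s′} (inject₁≢suc i)

      diagonal-fits : ∀ {s s′ e} → s ≢ s′ → Joins (edge G e) (on s (inject₁ i)) (on s′ (suc i)) →
        Fits e (on s (inject₁ i)) (on s′ (suc i))
      diagonal-fits {s} {s′} {e} s≢s′ jₑ =
        square-cutColour {c = c} nac c₀ ψ e (index (link i s′ s′)) (spoke s′) (spoke s) distinct
          jₑ (Joins-sym (joins (link i s′ s′))) (Joins-sym (spoke-joins s′)) (spoke-joins s)
          (trans (canonical-straight-fits i s′) (cutColour-sym c₀ ψ (on s′ (inject₁ i)) (on s′ (suc i))))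
          (trans (spoke-fits s′) (cutColour-sym c₀ ψ apex (on s′ (inject₁ i))))
          (spoke-fits s)
        where
        distinct : Unique (on s (inject₁ i) ∷ on s′ (suc i) ∷ on s′ (inject₁ i) ∷ apex ∷ [])
        distinct = (rails-≢ s≢s′ ∷ rails-≢ s≢s′ ∷ lower≢apex s ∷ [])
                 ∷ (≢-sym (lower≢upper s′ s′) ∷ upper≢apex s′ ∷ [])
                 ∷ (lower≢apex s′ ∷ []) ∷ [] ∷ []

      straight-fits : ∀ {s e} → Joins (edge G e) (on s (inject₁ i)) (on s (suc i)) →
        Fits e (on s (inject₁ i)) (on s (suc i))
      straight-fits {s} {e} jₑ =
        square-cutColour {c = c} nac c₀ ψ e (index (link i s̄ s)) (spoke s̄) (spoke s) distinct
          jₑ (Joins-sym (joins (link i s̄ s))) (Joins-sym (spoke-joins s̄)) (spoke-joins s)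
          (trans (diagonal-fits (≢-sym (≢-opposite s)) (joins (link i s̄ s)))
                 (cutColour-sym c₀ ψ (on s̄ (inject₁ i)) (on s (suc i))))
          (trans (spoke-fits s̄) (cutColour-sym c₀ ψ apex (on s̄ (inject₁ i))))
          (spoke-fits s)
        where
        s̄ = opposite s
        distinct : Unique (on s (inject₁ i) ∷ on s (suc i) ∷ on s̄ (inject₁ i) ∷ apex ∷ [])
        distinct = (lower≢upper s s ∷ rails-≢ (≢-opposite s) ∷ lower≢apex s ∷ [])
                 ∷ (rails-≢ (≢-opposite s) ∷ upper≢apex s ∷ [])
                 ∷ (lower≢apex s̄ ∷ []) ∷ [] ∷ []

      link-fits : ∀ s s′ {e} → Joins (edge G e) (on s (inject₁ i)) (on s′ (suc i)) →
        Fits e (on s (inject₁ i)) (on s′ (suc i))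
      link-fits railA railA = straight-fits {railA}
      link-fits railB railB = straight-fits {railB}
      link-fits railA railB = diagonal-fits {railA} {railB} (λ ())
      link-fits railB railA = diagonal-fits {railB} {railA} (λ ())

      anchor-step : Anchor (suc i)
      anchor-step = record
        { apex        = on railA (inject₁ i)
        ; apex-below  = λ s j′ above eq → n≮n (toℕ i) (subst (suc (toℕ i) ≤_) (level {s} {j′} eq) above)
        ; spoke       = λ s → index (link i railA s)
        ; spoke-joins = λ s → joins (link i railA s)
        ; spoke-fits  = λ s → link-fits railA s (joins (link i railA s))
        }
        where
        level : ∀ {s j′} → on railA (inject₁ i) ≡ on s j′ → toℕ j′ ≡ toℕ i
        level {s} eq = trans (cong toℕ (sym (proj₂ (on-injective {railA} {s} eq)))) (toℕ-inject₁ i)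

    anchors : ∀ j → Anchor j
    anchors = <-weakInduction Anchor anchor-zero (λ i → anchor-step {i})

    colour-fits : ∀ e → vlookup c e ≡ cutColour c₀ ψ (edge G e)
    colour-fits e with classify e
    ... | ε , eq = trans (fits-ends ε eq) (cong (cutColour c₀ ψ) (sym eq))
      where
      fits-ends : ∀ ε → edge G e ≡ ends ε → vlookup c e ≡ cutColour c₀ ψ (ends ε)
      fits-ends xy            eq = xy-colour e eq
      fits-ends (xTo s)       eq = trans (xTo-colour s e eq) (sym (hub-cut s))
      fits-ends (yTo s)       eq = trans (yTo-colour s e eq) (sym (hub-cut s))
      fits-ends (link i s s′) eq = link-fits (anchors (inject₁ i)) s s′ (≡⇒Joins eq)

    encode-decode : encode (decode c) ≡ c
    encode-decode = trans (tabulate-cong (sym ∘ colour-fits)) (tabulate∘lookup c)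

    decode-nonzero : true ∈ᵥ bs
    decode-nonzero with another-colour {G} {c} c₀ (proj₁ nac)
    ... | e , cₑ = [ potential≡true bs u , potential≡true bs w ]′
                     (xor≡not⇒true (ψ u) (ψ w) c₀ (trans (sym (colour-fits e)) cₑ))
      where
      u = proj₁ (edge G e)
      w = proj₂ (edge G e)

  codes : List Code
  codes = cartesianProduct (true ∷ false ∷ []) (nonzeroBitVectors (k + k))

  ∈-codes : ∀ {c₀ bs} → (c₀ , bs) ∈ codes ⇔ true ∈ᵥ bs
  ∈-codes {c₀} =
    mk⇔ (to ∈-nonzeroBitVectors ∘ proj₂ ∘ ∈-cartesianProduct⁻ (true ∷ false ∷ []) _)
        (∈-cartesianProduct⁺ {xs = true ∷ false ∷ []} (colour∈ c₀) ∘ from ∈-nonzeroBitVectors)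
    where
    colour∈ : ∀ c₀ → c₀ ∈ true ∷ false ∷ []
    colour∈ true  = here refl
    colour∈ false = there (here refl)

  codes-unique : Unique codes
  codes-unique = cartesianProduct⁺ (((λ ()) ∷ []) ∷ [] ∷ []) (nonzeroBitVectors-unique (k + k))

  nacColourings : List (Colouring G)
  nacColourings = map encode codes

  nacColourings-NACList : NACList G nacColourings
  nacColourings-NACList = map⁺ encode-injective codes-unique , λ c → mk⇔ (sound c) (complete c)
    where
    sound : ∀ c → c ∈ nacColourings → IsNAC G c
    sound c mem with ∈-map⁻ encode mem
    ... | (c₀ , bs) , code∈ , refl = encode-IsNAC c₀ bs (to ∈-codes code∈)
    complete : ∀ c → IsNAC G c → c ∈ nacColourings
    complete c nac = subst (_∈ nacColourings) encode-decode (∈-map⁺ encode (from ∈-codes decode-nonzero))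
      where open Decoding c nac

  half-length : length nacColourings / 2 ≡ 2 ^ (n G ∸ 4) ∸ 1
  half-length = begin
    length nacColourings / 2   ≡⟨ cong (_/ 2) (length-map encode codes) ⟩
    length codes / 2           ≡⟨ cong (_/ 2) (trans (length-cartesianProduct (true ∷ false ∷ []) nz)
                                                     (*-comm 2 (length nz))) ⟩
    length nz * 2 / 2          ≡⟨ m*n/n≡m (length nz) 2 ⟩
    length nz                  ≡⟨ cong (_∸ 1) (length-nonzeroBitVectors (k + k)) ⟩
    2 ^ (k + k) ∸ 1            ≡⟨ cong (λ d → 2 ^ (d ∸ 1) ∸ 1) (+-suc k k) ⟨
    2 ^ (n G ∸ 4) ∸ 1          ∎
    where
    open ≡-Reasoning
    nz = nonzeroBitVectors (k + k)

proposition5p3 : (k : ℕ) → .{{_ : NonZero k}} → 2 ≤ k →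
    ∃[ L ] (NACList (Gk k) L × length L / 2 ≡ 2 ^ (n (Gk k) ∸ 4) ∸ 1)
proposition5p3 (suc k) _ = nacColourings , nacColourings-NACList , half-length
  where open Ladder k
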